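{- Let $d,k\geq 1$ be integers. There is a constant $B_{d,k}$ (depending only on $d,k$) such that $f(n,d,k)\leq C_{d,k}\,n+B_{d,k}$ for all integers $n\geq 1$, where $C_{d,k}$ is defined as follows. If $d$ is odd, write $k=(d+1)q/2+r$ with $q,r\in\mathbb{Z}$ and $1\leq r\leq (d+1)/2$; then $$C_{d,k}=(q+1)\left(1+\frac{r-1}{(d+1)(q+2)/2-(r-1)}\right).$$ If $d$ is even, write $k=(d+1)q+r$ with $q,r\in\mathbb{Z}$ and $1\leq r\leq d+1$; then $$C_{d,k}=\begin{cases}(2q+1)\left(1+\frac{r-1}{(d+1)(q+1)-(r-1)}\right) & \text{if } 1\leq r\leq d/2+1,\\ (2q+3)\left(1-\frac{d+2-r}{(d+1)(q+1)+(d+2-r)}\right) & \text{otherwise.}\end{cases}$$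
   Context: For integers $n\geq 1$, $d\geq 1$, the triangular grid is $T_d(n):=\{(x_1,\dots,x_d)\in\mathbb{Z}_{\geq 0}^d : x_1+\dots+x_d\leq n-1\}$. For an integer $k\geq 1$, a $k$-cover of $T_d(n)$ is a finite multiset of affine hyperplanes of $\mathbb{R}^d$ such that every point of $T_d(n)$ lies in at least $k$ of its members (counted with multiplicity); $f(n,d,k)$ is the minimum cardinality (with multiplicity) of a $k$-cover of $T_d(n)$. -}

module Defs where

open import Data.Nat as ℕ using (ℕ; zero; suc; _∸_; _≤?_)
open import Data.Integer as ℤ using (ℤ; +_)
open import Data.Vec using (Vec; []; _∷_; sum)
open import Data.Vec.Relation.Unary.Any using (Any)
open import Data.List using (List; length; filter)
open import Data.Rational as ℚ using (ℚ; 0ℚ; 1ℚ)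
open import Relation.Binary.PropositionalEquality using (_≡_; _≢_)
open import Relation.Nullary using (Dec; yes; no)

dot : ∀ {d} → Vec ℤ d → Vec ℕ d → ℤ
dot [] [] = + 0
dot (a ∷ as) (x ∷ xs) = a ℤ.* (+ x) ℤ.+ dot as xs

record Hyperplane (d : ℕ) : Set where
  constructor hyperplane
  field
    coeff   : Vec ℤ d
    const   : ℤ
    nonzero : Any (λ a → a ≢ + 0) coeff

open Hyperplane public

_∈H_ : ∀ {d} → Vec ℕ d → Hyperplane d → Set
p ∈H H = dot (coeff H) p ≡ const H

_∈H?_ : ∀ {d} (p : Vec ℕ d) (H : Hyperplane d) → Dec (p ∈H H)
p ∈H? H = dot (coeff H) p ℤ.≟ const H

InT : (d n : ℕ) → Vec ℕ d → Set
InT d n p = sum p ℕ.< n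

mult : ∀ {d} → List (Hyperplane d) → Vec ℕ d → ℕ
mult Hs p = length (filter (λ H → p ∈H? H) Hs)

IsKCover : (d n k : ℕ) → List (Hyperplane d) → Set
IsKCover d n k Hs = (p : Vec ℕ d) → InT d n p → k ℕ.≤ mult Hs p

ℕ→ℚ : ℕ → ℚ
ℕ→ℚ n = (+ n) ℚ./ 1

-- a / b as a rational; only ever used with b > 0 (convention b = 0 ↦ 0)
frac : ℕ → ℕ → ℚ
frac a zero    = 0ℚ
frac a (suc b) = (+ a) ℚ./ suc b

-- d odd: k = ((d+1)/2) q + r, 1 ≤ r ≤ (d+1)/2, where (d+1)/2 = suc (d / 2)
C-odd : (d k : ℕ) → ℚ
C-odd d k =
  let m = suc (d ℕ./ 2)
      q = (k ∸ 1) ℕ./ m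
      r = suc ((k ∸ 1) ℕ.% m)
  in ℕ→ℚ (suc q) ℚ.* (1ℚ ℚ.+ frac (r ∸ 1) (m ℕ.* (q ℕ.+ 2) ∸ (r ∸ 1)))

C-even : (d k : ℕ) → ℚ
C-even d k with (k ∸ 1) ℕ./ suc d | suc ((k ∸ 1) ℕ.% suc d)
... | q | r with r ≤? suc (d ℕ./ 2)
...   | yes _ = ℕ→ℚ (2 ℕ.* q ℕ.+ 1)
                  ℚ.* (1ℚ ℚ.+ frac (r ∸ 1) (suc d ℕ.* suc q ∸ (r ∸ 1)))
...   | no  _ = ℕ→ℚ (2 ℕ.* q ℕ.+ 3)
                  ℚ.* (1ℚ ℚ.- frac (d ℕ.+ 2 ∸ r) (suc d ℕ.* suc q ℕ.+ (d ℕ.+ 2 ∸ r)))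

C : (d k : ℕ) → ℚ
C d k with d ℕ.% 2
... | zero  = C-even d k
... | suc _ = C-odd d k

{-# OPTIONS --safe #-}
-- Every point of T_d(n) has d + 1 barycentric coordinates x₁, …, x_d, n − 1 − Σxᵢ, and each of
-- them comes with a family of parallel hyperplanes {coordinate = c}.  Fix a, s ≥ 1 and take, for
-- every direction and every level l = 1, …, a, the hyperplanes with c ≤ nl/s.  A coordinate of
-- value v is then covered at least a − vs/n times; as the coordinates sum to n − 1, every point
-- is covered more than (d + 1)a − s times, so k + s ≤ (d + 1)a + 1 yields a k-cover.  Its size is
-- (d + 1) Σ_{l ≤ a} (⌊nl/s⌋ + 1) ≤ (d + 1)a(a + 1) n / (2s) + (d + 1)a.  Writing k − 1 = qm + ρ,
-- C_{d,k} is exactly the slope (d + 1)a(a + 1)/(2s) for (a, s) = (q + 1, m(q + 2) − ρ) when d is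
-- odd and m = (d + 1)/2, and for (2q + 1, (d + 1)(q + 1) − ρ) or (2q + 2, (d + 1)(q + 2) − ρ)
-- when d is even and m = d + 1.
module Submission where

open import Defs
open import Data.Nat using (ℕ; _≤_)
open import Data.List using (List; length)
open import Data.Product using (∃-syntax; _×_)
open import Data.Rational as ℚ using (ℚ)

open import Data.Nat as ℕ
  using (zero; suc; _+_; _*_; _∸_; _<_; z≤n; s≤s; NonZero; >-nonZero; >-nonZero⁻¹; z<s; _≤?_)
open import Data.Nat.Properties
open import Data.Nat.DivMod using (_/_; _%_; m/n*n≤m; m*n/n≡m; /-monoˡ-≤; m≡m%n+[m/n]*n; m%n<n)
open import Data.Nat.Tactic.RingSolver using (solve-∀)
open import Data.Integer as ℤ using (+_)
import Data.Integer.Properties as ℤP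
import Data.Integer.Tactic.RingSolver as ℤ-Solver
open import Data.Rational using (0ℚ; 1ℚ)
import Data.Rational.Properties as ℚP
open import Data.Rational.Unnormalised as ℚᵘ using (mkℚᵘ; *≡*; *≤*)
import Data.Rational.Unnormalised.Properties as ℚᵘP
open import Data.Vec using (Vec; []; _∷_; replicate; sum)
open import Data.Vec.Relation.Unary.Any using (here; there)
open import Data.List using ([]; _∷_; _++_; map; filter; applyUpTo)
open import Data.List.Properties using (filter-++; length-++; length-map; length-applyUpTo)
open import Data.List.Membership.Propositional using (_∈_)
open import Data.List.Membership.Propositional.Properties using (∈-filter⁺; ∈-length; ∈-applyUpTo⁺)
open import Data.Product using (_,_)
open import Function.Bundles using (_⇔_; mk⇔; Equivalence)
open import Level using (0ℓ)
open import Relation.Binary.PropositionalEquality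
open import Relation.Nullary using (yes; no; contradiction)
open import Relation.Nullary.Decidable.Core using (dec⇒maybe)
import Tactic.RingSolver as RingSolver
open import Tactic.RingSolver.Core.AlmostCommutativeRing using (AlmostCommutativeRing; fromCommutativeRing)

mult-++ : ∀ {d} (Hs Gs : List (Hyperplane d)) p → mult (Hs ++ Gs) p ≡ mult Hs p + mult Gs p
mult-++ Hs Gs p = trans (cong length (filter-++ (p ∈H?_) Hs Gs)) (length-++ (filter (p ∈H?_) Hs))

mult-∈ : ∀ {d} {H : Hyperplane d} {Hs p} → H ∈ Hs → p ∈H H → 1 ≤ mult Hs p
mult-∈ {p = p} H∈Hs p∈H = ∈-length (∈-filter⁺ (p ∈H?_) H∈Hs p∈H)

mult-map : ∀ {d e} (f : Hyperplane d → Hyperplane e) {q p} →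
           (∀ H → q ∈H f H ⇔ p ∈H H) → ∀ Hs → mult (map f Hs) q ≡ mult Hs p
mult-map f eq [] = refl
mult-map f {q} {p} eq (H ∷ Hs) with q ∈H? f H | p ∈H? H
... | yes _   | yes _   = cong suc (mult-map f eq Hs)
... | no _    | no _    = mult-map f eq Hs
... | yes q∈  | no p∉   = contradiction (Equivalence.to (eq H) q∈) p∉
... | no q∉   | yes p∈  = contradiction (Equivalence.from (eq H) p∈) q∉

dot-zeros : ∀ {d} (p : Vec ℕ d) → dot (replicate d (+ 0)) p ≡ + 0
dot-zeros [] = refl
dot-zeros (x ∷ p) = trans (cong (ℤ._+ dot (replicate _ (+ 0)) p) (ℤP.*-zeroˡ (+ x)))
  (trans (ℤP.+-identityˡ _) (dot-zeros p))

dot-ones : ∀ {d} (p : Vec ℕ d) → dot (replicate d (+ 1)) p ≡ + sum p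
dot-ones [] = refl
dot-ones (x ∷ p) = trans (cong₂ ℤ._+_ (ℤP.*-identityˡ (+ x)) (dot-ones p)) (sym (ℤP.pos-+ x (sum p)))

diagonal : ∀ {d} → ℕ → Hyperplane (suc d)
diagonal {d} c = hyperplane (replicate (suc d) (+ 1)) (+ c) (here λ ())

firstCoordinate : ∀ {d} → ℕ → Hyperplane (suc d)
firstCoordinate {d} c = hyperplane (+ 1 ∷ replicate d (+ 0)) (+ c) (here λ ())

lift : ∀ {d} → Hyperplane d → Hyperplane (suc d)
lift H = hyperplane (+ 0 ∷ coeff H) (const H) (there (nonzero H))

∈-diagonal : ∀ {d} (p : Vec ℕ (suc d)) → p ∈H diagonal (sum p)
∈-diagonal = dot-ones

∈-firstCoordinate : ∀ {d} x (p : Vec ℕ d) → (x ∷ p) ∈H firstCoordinate x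
∈-firstCoordinate x p = trans (cong₂ ℤ._+_ (ℤP.*-identityˡ (+ x)) (dot-zeros p)) (ℤP.+-identityʳ (+ x))

∈-lift : ∀ {d} x (p : Vec ℕ d) H → (x ∷ p) ∈H lift H ⇔ p ∈H H
∈-lift x p H = mk⇔ (trans (sym dot-lift)) (trans dot-lift)
  where
  dot-lift : dot (+ 0 ∷ coeff H) (x ∷ p) ≡ dot (coeff H) p
  dot-lift = trans (cong (ℤ._+ dot (coeff H) p) (ℤP.*-zeroˡ (+ x))) (ℤP.+-identityˡ _)

module LayeredCover (n s a : ℕ) .{{_ : NonZero s}} where

  layer : ∀ {d} → (ℕ → Hyperplane d) → ℕ → List (Hyperplane d)
  layer H l = applyUpTo H (suc (n * l / s))

  layers : ∀ {d} → (ℕ → Hyperplane d) → ℕ → List (Hyperplane d)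
  layers H zero    = []
  layers H (suc l) = layer H (suc l) ++ layers H l

  layerCount : ℕ → ℕ
  layerCount zero    = 0
  layerCount (suc l) = suc (n * suc l / s) + layerCount l

  length-layers : ∀ {d} (H : ℕ → Hyperplane d) l → length (layers H l) ≡ layerCount l
  length-layers H zero    = refl
  length-layers H (suc l) = trans (length-++ (layer H (suc l)))
    (cong₂ _+_ (length-applyUpTo H (suc (n * suc l / s))) (length-layers H l))

  layerCount-bound : ∀ l → layerCount l * (2 * s) ≤ n * (l * suc l) + l * (2 * s)
  layerCount-bound zero    = z≤n
  layerCount-bound (suc l) =
    step (n * suc l / s) (layerCount l) (m/n*n≤m (n * suc l) s) (layerCount-bound l)
    where
    step : ∀ x t → x * s ≤ n * suc l → t * (2 * s) ≤ n * (l * suc l) + l * (2 * s) →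
           (suc x + t) * (2 * s) ≤ n * (suc l * suc (suc l)) + suc l * (2 * s)
    step x t xs≤ ts≤ = begin
      (suc x + t) * (2 * s)                                     ≡⟨ expand x t s ⟩
      2 * (x * s) + 2 * s + t * (2 * s)                         ≤⟨ +-mono-≤ (+-monoˡ-≤ (2 * s) (*-monoʳ-≤ 2 xs≤)) ts≤ ⟩
      2 * (n * suc l) + 2 * s + (n * (l * suc l) + l * (2 * s)) ≡⟨ collect n l s ⟩
      n * (suc l * suc (suc l)) + suc l * (2 * s)               ∎
      where
      open ≤-Reasoning
      expand : ∀ x t s → (suc x + t) * (2 * s) ≡ 2 * (x * s) + 2 * s + t * (2 * s)
      expand = solve-∀
      collect : ∀ n l s → 2 * (n * suc l) + 2 * s + (n * (l * suc l) + l * (2 * s))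
                        ≡ n * (suc l * suc (suc l)) + suc l * (2 * s)
      collect = solve-∀

  ∈-layer : ∀ {d} (H : ℕ → Hyperplane d) {v} l → v * s ≤ n * l → H v ∈ layer H l
  ∈-layer H {v} l vs≤nl =
    ∈-applyUpTo⁺ H (s≤s (subst (_≤ n * l / s) (m*n/n≡m v s) (/-monoˡ-≤ s vs≤nl)))

  layers-mult : ∀ {d} (H : ℕ → Hyperplane d) {p v} → p ∈H H v →
                ∀ l → n * l ≤ n * mult (layers H l) p + v * s
  layers-mult H p∈ zero rewrite *-zeroʳ n = z≤n
  layers-mult H {p} {v} p∈ (suc l) with v * s ≤? n * suc l
  ... | yes vs≤ = begin
    n * suc l                                  ≡⟨ *-suc n l ⟩
    n + n * l                                  ≤⟨ +-monoʳ-≤ n (layers-mult H p∈ l) ⟩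
    n + (n * R + v * s)                        ≡⟨ sym (+-assoc n (n * R) (v * s)) ⟩
    n + n * R + v * s                          ≡⟨ cong (_+ v * s) (sym (*-suc n R)) ⟩
    n * suc R + v * s                          ≤⟨ +-monoˡ-≤ (v * s) (*-monoʳ-≤ n (+-monoˡ-≤ R hit)) ⟩
    n * (mult (layer H (suc l)) p + R) + v * s ≡⟨ cong (λ m → n * m + v * s) (sym split) ⟩
    n * mult (layers H (suc l)) p + v * s      ∎
    where
    open ≤-Reasoning
    R = mult (layers H l) p
    hit : 1 ≤ mult (layer H (suc l)) p
    hit = mult-∈ (∈-layer H (suc l) vs≤) p∈
    split : mult (layers H (suc l)) p ≡ mult (layer H (suc l)) p + R
    split = mult-++ (layer H (suc l)) (layers H l) p
  ... | no vs≰ = ≤-trans (≰⇒≥ vs≰) (m≤n+m (v * s) _)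

  record MultBound {d} (Hs : List (Hyperplane d)) (p : Vec ℕ d) (m v : ℕ) : Set where
    constructor multBound
    field bound : m * (n * a) ≤ n * mult Hs p + v * s

  MultBound-++ : ∀ {d} {Hs Gs : List (Hyperplane d)} {p m₁ m₂ v₁ v₂} →
                 MultBound Hs p m₁ v₁ → MultBound Gs p m₂ v₂ → MultBound (Hs ++ Gs) p (m₁ + m₂) (v₁ + v₂)
  MultBound-++ {Hs = Hs} {Gs} {p} {m₁} {m₂} {v₁} {v₂} (multBound b₁) (multBound b₂) = multBound (begin
    (m₁ + m₂) * (n * a)                                 ≡⟨ *-distribʳ-+ (n * a) m₁ m₂ ⟩
    m₁ * (n * a) + m₂ * (n * a)                         ≤⟨ +-mono-≤ b₁ b₂ ⟩
    n * mult Hs p + v₁ * s + (n * mult Gs p + v₂ * s)   ≡⟨ regroup n (mult Hs p) (mult Gs p) v₁ v₂ s ⟩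
    n * (mult Hs p + mult Gs p) + (v₁ + v₂) * s         ≡⟨ cong (λ m → n * m + (v₁ + v₂) * s) (sym (mult-++ Hs Gs p)) ⟩
    n * mult (Hs ++ Gs) p + (v₁ + v₂) * s               ∎)
    where
    open ≤-Reasoning
    regroup : ∀ n x y v w s → n * x + v * s + (n * y + w * s) ≡ n * (x + y) + (v + w) * s
    regroup = solve-∀

  layers-multBound : ∀ {d} (H : ℕ → Hyperplane d) {p v} → p ∈H H v → MultBound (layers H a) p 1 v
  layers-multBound H {p} {v} p∈ =
    multBound (subst (_≤ n * mult (layers H a) p + v * s) (sym (*-identityˡ (n * a))) (layers-mult H p∈ a))

  coordinateLayers : ∀ d → List (Hyperplane d)
  coordinateLayers zero    = []
  coordinateLayers (suc d) = layers firstCoordinate a ++ map lift (coordinateLayers d)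

  coordinateLayers-multBound : ∀ {d} (p : Vec ℕ d) → MultBound (coordinateLayers d) p d (sum p)
  coordinateLayers-multBound []      = multBound z≤n
  coordinateLayers-multBound {suc d} (x ∷ p) = MultBound-++
    (layers-multBound firstCoordinate (∈-firstCoordinate x p))
    (multBound (subst (λ m → d * (n * a) ≤ n * m + sum p * s)
      (sym (mult-map lift (∈-lift x p) (coordinateLayers d))) (MultBound.bound (coordinateLayers-multBound p))))

  length-coordinateLayers : ∀ d → length (coordinateLayers d) ≡ d * layerCount a
  length-coordinateLayers zero    = refl
  length-coordinateLayers (suc d) = trans (length-++ (layers firstCoordinate a))
    (cong₂ _+_ (length-layers firstCoordinate a)
      (trans (length-map lift (coordinateLayers d)) (length-coordinateLayers d)))

  -- indexed by the barycentric coordinate n − 1 − Σxᵢ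
  diagonalFamily : ∀ {d} → ℕ → Hyperplane (suc d)
  diagonalFamily c = diagonal (ℕ.pred n ∸ c)

  simplexCover : ∀ d → List (Hyperplane (suc d))
  simplexCover d = layers diagonalFamily a ++ coordinateLayers (suc d)

  simplexCover-multBound : ∀ {d} (p : Vec ℕ (suc d)) → sum p < n →
                           MultBound (simplexCover d) p (suc (suc d)) (ℕ.pred n)
  simplexCover-multBound p p<n =
    subst (MultBound (simplexCover _) p (suc (suc _))) (m∸n+n≡m sum≤)
      (MultBound-++ (layers-multBound diagonalFamily p∈) (coordinateLayers-multBound p))
    where
    sum≤ : sum p ≤ ℕ.pred n
    sum≤ = <⇒≤pred p<n
    p∈ : p ∈H diagonalFamily (ℕ.pred n ∸ sum p)
    p∈ = subst (λ c → p ∈H diagonal c) (sym (m∸[m∸n]≡n sum≤)) (∈-diagonal p)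

  length-simplexCover : ∀ d → length (simplexCover d) ≡ suc (suc d) * layerCount a
  length-simplexCover d = trans (length-++ (layers diagonalFamily a))
    (cong₂ _+_ (length-layers diagonalFamily a) (length-coordinateLayers (suc d)))

  MultBound⇒≤mult : ∀ {d} {Hs : List (Hyperplane d)} {p m k} .{{_ : NonZero n}} →
                    k + s ≤ m * a + 1 → MultBound Hs p m (ℕ.pred n) → k ≤ mult Hs p
  MultBound⇒≤mult {Hs = Hs} {p} {m} {k} hk (multBound b) = cancel n b
    where
    M = mult Hs p
    cancel : ∀ n′ .{{_ : NonZero n′}} → m * (n′ * a) ≤ n′ * M + ℕ.pred n′ * s → k ≤ M
    cancel n′@(suc n′-1) hb = ≤-pred (*-cancelˡ-< n′ k (suc M) (begin-strict
      n′ * k            <⟨ m<m+n (n′ * k) (>-nonZero⁻¹ s) ⟩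
      n′ * k + s        ≤⟨ +-cancelʳ-≤ (n′-1 * s) _ _ scaled ⟩
      n′ * M + n′       ≡⟨ +-comm (n′ * M) n′ ⟩
      n′ + n′ * M       ≡⟨ *-suc n′ M ⟨
      n′ * suc M        ∎))
      where
      open ≤-Reasoning
      scaled : n′ * k + s + n′-1 * s ≤ n′ * M + n′ + n′-1 * s
      scaled = begin
        n′ * k + s + n′-1 * s    ≡⟨ expand n′-1 k s ⟩
        n′ * (k + s)             ≤⟨ *-monoʳ-≤ n′ hk ⟩
        n′ * (m * a + 1)         ≡⟨ distribute n′ m a ⟩
        m * (n′ * a) + n′        ≤⟨ +-monoˡ-≤ n′ hb ⟩
        n′ * M + n′-1 * s + n′   ≡⟨ swap (n′ * M) (n′-1 * s) n′ ⟩
        n′ * M + n′ + n′-1 * s   ∎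
        where
        expand : ∀ n k s → suc n * k + s + n * s ≡ suc n * (k + s)
        expand = solve-∀
        distribute : ∀ n m a → n * (m * a + 1) ≡ m * (n * a) + n
        distribute = solve-∀
        swap : ∀ x y z → x + y + z ≡ x + z + y
        swap = solve-∀

  simplexCover-isKCover : ∀ {d k} .{{_ : NonZero n}} → k + s ≤ suc (suc d) * a + 1 →
                          IsKCover (suc d) n k (simplexCover d)
  simplexCover-isKCover hk p p<n = MultBound⇒≤mult hk (simplexCover-multBound p p<n)

  length-simplexCover-bound : ∀ d → length (simplexCover d) * (2 * s)
                                    ≤ n * (suc (suc d) * a * suc a) + suc (suc d) * a * (2 * s)
  length-simplexCover-bound d = begin
    length (simplexCover d) * (2 * s)      ≡⟨ cong (_* (2 * s)) (length-simplexCover d) ⟩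
    D * layerCount a * (2 * s)             ≡⟨ *-assoc D (layerCount a) (2 * s) ⟩
    D * (layerCount a * (2 * s))           ≤⟨ *-monoʳ-≤ D (layerCount-bound a) ⟩
    D * (n * (a * suc a) + a * (2 * s))    ≡⟨ distribute D n a s ⟩
    n * (D * a * suc a) + D * a * (2 * s)  ∎
    where
    open ≤-Reasoning
    D = suc (suc d)
    distribute : ∀ D n a s → D * (n * (a * suc a) + a * (2 * s)) ≡ n * (D * a * suc a) + D * a * (2 * s)
    distribute = solve-∀

-- the zero test lets the solver cancel terms such as y − y
ℚ-ring : AlmostCommutativeRing 0ℓ 0ℓ
ℚ-ring = fromCommutativeRing ℚP.+-*-commutativeRing (λ x → dec⇒maybe (0ℚ ℚP.≟ x))

toℚᵘ-ℕ→ℚ : ∀ n → ℚ.toℚᵘ (ℕ→ℚ n) ℚᵘ.≃ mkℚᵘ (+ n) 0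
toℚᵘ-ℕ→ℚ n = ℚP.toℚᵘ-fromℚᵘ (mkℚᵘ (+ n) 0)

ℕ→ℚ-+ : ∀ m n → ℕ→ℚ (m + n) ≡ ℕ→ℚ m ℚ.+ ℕ→ℚ n
ℕ→ℚ-+ m n = ℚP.toℚᵘ-injective (begin
  ℚ.toℚᵘ (ℕ→ℚ (m + n))                ≈⟨ toℚᵘ-ℕ→ℚ (m + n) ⟩
  mkℚᵘ (+ (m + n)) 0                   ≈⟨ *≡* (clearDenominators (+ m) (+ n)) ⟩
  mkℚᵘ (+ m) 0 ℚᵘ.+ mkℚᵘ (+ n) 0       ≈⟨ ℚᵘP.+-cong (toℚᵘ-ℕ→ℚ m) (toℚᵘ-ℕ→ℚ n) ⟨
  ℚ.toℚᵘ (ℕ→ℚ m) ℚᵘ.+ ℚ.toℚᵘ (ℕ→ℚ n)  ≈⟨ ℚP.toℚᵘ-homo-+ (ℕ→ℚ m) (ℕ→ℚ n) ⟨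
  ℚ.toℚᵘ (ℕ→ℚ m ℚ.+ ℕ→ℚ n)             ∎)
  where
  open ℚᵘP.≃-Reasoning
  clearDenominators : ∀ x y → (x ℤ.+ y) ℤ.* (+ 1 ℤ.* + 1) ≡ (x ℤ.* + 1 ℤ.+ y ℤ.* + 1) ℤ.* + 1
  clearDenominators = ℤ-Solver.solve-∀

ℕ→ℚ-* : ∀ m n → ℕ→ℚ (m * n) ≡ ℕ→ℚ m ℚ.* ℕ→ℚ n
ℕ→ℚ-* m n = ℚP.toℚᵘ-injective (begin
  ℚ.toℚᵘ (ℕ→ℚ (m * n))                ≈⟨ toℚᵘ-ℕ→ℚ (m * n) ⟩
  mkℚᵘ (+ (m * n)) 0                   ≈⟨ *≡* (cong (ℤ._* + 1) (ℤP.pos-* m n)) ⟩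
  mkℚᵘ (+ m) 0 ℚᵘ.* mkℚᵘ (+ n) 0       ≈⟨ ℚᵘP.*-cong (toℚᵘ-ℕ→ℚ m) (toℚᵘ-ℕ→ℚ n) ⟨
  ℚ.toℚᵘ (ℕ→ℚ m) ℚᵘ.* ℚ.toℚᵘ (ℕ→ℚ n)  ≈⟨ ℚP.toℚᵘ-homo-* (ℕ→ℚ m) (ℕ→ℚ n) ⟨
  ℚ.toℚᵘ (ℕ→ℚ m ℚ.* ℕ→ℚ n)             ∎)
  where open ℚᵘP.≃-Reasoning

ℕ→ℚ-mono-≤ : ∀ {m n} → m ≤ n → ℕ→ℚ m ℚ.≤ ℕ→ℚ n
ℕ→ℚ-mono-≤ {m} {n} m≤n = ℚP.toℚᵘ-cancel-≤
  (ℚᵘP.≤-respˡ-≃ (ℚᵘP.≃-sym (toℚᵘ-ℕ→ℚ m)) (ℚᵘP.≤-respʳ-≃ (ℚᵘP.≃-sym (toℚᵘ-ℕ→ℚ n))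
    (*≤* (ℤP.*-monoʳ-≤-nonNeg (+ 1) (ℤ.+≤+ m≤n)))))

ℕ→ℚ-positive : ∀ n .{{_ : NonZero n}} → ℚ.Positive (ℕ→ℚ n)
ℕ→ℚ-positive n = ℚP.normalize-pos n 1

frac-* : ∀ u s .{{_ : NonZero s}} → frac u s ℚ.* ℕ→ℚ s ≡ ℕ→ℚ u
frac-* u s@(suc s-1) = ℚP.toℚᵘ-injective (begin
  ℚ.toℚᵘ (frac u s ℚ.* ℕ→ℚ s)              ≈⟨ ℚP.toℚᵘ-homo-* (frac u s) (ℕ→ℚ s) ⟩
  ℚ.toℚᵘ (frac u s) ℚᵘ.* ℚ.toℚᵘ (ℕ→ℚ s)    ≈⟨ ℚᵘP.*-cong (ℚP.toℚᵘ-fromℚᵘ (mkℚᵘ (+ u) s-1)) (toℚᵘ-ℕ→ℚ s) ⟩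
  mkℚᵘ (+ u) s-1 ℚᵘ.* mkℚᵘ (+ s) 0          ≈⟨ *≡* (clearDenominators (+ u) (+ s)) ⟩
  mkℚᵘ (+ u) 0                               ≈⟨ toℚᵘ-ℕ→ℚ u ⟨
  ℚ.toℚᵘ (ℕ→ℚ u)                            ∎)
  where
  open ℚᵘP.≃-Reasoning
  clearDenominators : ∀ x y → (x ℤ.* y) ℤ.* + 1 ≡ x ℤ.* (y ℤ.* + 1)
  clearDenominators = ℤ-Solver.solve-∀

ℕ→ℚ-*-* : ∀ l m n → ℕ→ℚ (l * m * n) ≡ ℕ→ℚ l ℚ.* ℕ→ℚ m ℚ.* ℕ→ℚ n
ℕ→ℚ-*-* l m n = trans (ℕ→ℚ-* (l * m) n) (cong (ℚ._* ℕ→ℚ n) (ℕ→ℚ-* l m))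

AchievableSlope : ℕ → ℕ → ℚ → Set
AchievableSlope d k c = ∃[ B ] ((n : ℕ) → 1 ≤ n →
  ∃[ Hs ] (IsKCover d n k Hs × ℕ→ℚ (length Hs) ℚ.≤ c ℚ.* ℕ→ℚ n ℚ.+ ℕ→ℚ B))

ℕ→ℚ-linearBound : ∀ {L n M B c} t .{{_ : NonZero t}} → L * t ≤ n * M + B * t →
                  c ℚ.* ℕ→ℚ t ≡ ℕ→ℚ M → ℕ→ℚ L ℚ.≤ c ℚ.* ℕ→ℚ n ℚ.+ ℕ→ℚ B
ℕ→ℚ-linearBound {L} {n} {M} {B} {c} t Lt≤ c≡ =
  ℚP.*-cancelʳ-≤-pos T {{ℕ→ℚ-positive t}} (begin
    ℕ→ℚ L ℚ.* T                           ≡⟨ ℕ→ℚ-* L t ⟨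
    ℕ→ℚ (L * t)                           ≤⟨ ℕ→ℚ-mono-≤ Lt≤ ⟩
    ℕ→ℚ (n * M + B * t)                   ≡⟨ trans (ℕ→ℚ-+ (n * M) (B * t)) (cong₂ ℚ._+_ (ℕ→ℚ-* n M) (ℕ→ℚ-* B t)) ⟩
    ℕ→ℚ n ℚ.* ℕ→ℚ M ℚ.+ ℕ→ℚ B ℚ.* T       ≡⟨ cong (λ x → ℕ→ℚ n ℚ.* x ℚ.+ ℕ→ℚ B ℚ.* T) c≡ ⟨
    ℕ→ℚ n ℚ.* (c ℚ.* T) ℚ.+ ℕ→ℚ B ℚ.* T   ≡⟨ factor (ℕ→ℚ n) c T (ℕ→ℚ B) ⟩
    (c ℚ.* ℕ→ℚ n ℚ.+ ℕ→ℚ B) ℚ.* T         ∎)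
  where
  open ℚP.≤-Reasoning
  T = ℕ→ℚ t
  factor : ∀ n c t b → n ℚ.* (c ℚ.* t) ℚ.+ b ℚ.* t ≡ (c ℚ.* n ℚ.+ b) ℚ.* t
  factor = RingSolver.solve-∀ ℚ-ring

achievableSlope : ∀ {d k} c a s .{{_ : NonZero s}} → 1 ≤ d → k + s ≤ suc d * a + 1 →
                  c ℚ.* ℕ→ℚ (2 * s) ≡ ℕ→ℚ (suc d * a * suc a) → AchievableSlope d k c
achievableSlope {suc d} {k} c a s _ hk c≡ = suc (suc d) * a , cover
  where
  cover : (n : ℕ) → 1 ≤ n → ∃[ Hs ] (IsKCover (suc d) n k Hs ×
                                      ℕ→ℚ (length Hs) ℚ.≤ c ℚ.* ℕ→ℚ n ℚ.+ ℕ→ℚ (suc (suc d) * a))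
  cover n@(suc _) _ = simplexCover d , simplexCover-isKCover hk ,
    ℕ→ℚ-linearBound {length (simplexCover d)} {n} {suc (suc d) * a * suc a} {suc (suc d) * a} {c}
      (2 * s) {{m*n≢0 2 s}} (length-simplexCover-bound d) c≡
    where open LayeredCover n s a

1+frac-slope : ∀ P u s .{{_ : NonZero s}} →
               ℕ→ℚ P ℚ.* (1ℚ ℚ.+ frac u s) ℚ.* ℕ→ℚ (2 * s) ≡ ℕ→ℚ (2 * P * (s + u))
1+frac-slope P u s = begin
  p ℚ.* (1ℚ ℚ.+ x) ℚ.* ℕ→ℚ (2 * s)  ≡⟨ cong (p ℚ.* (1ℚ ℚ.+ x) ℚ.*_) (ℕ→ℚ-* 2 s) ⟩
  p ℚ.* (1ℚ ℚ.+ x) ℚ.* (two ℚ.* S)  ≡⟨ expand p x two S ⟩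
  two ℚ.* p ℚ.* (S ℚ.+ x ℚ.* S)     ≡⟨ cong (λ y → two ℚ.* p ℚ.* (S ℚ.+ y)) (frac-* u s) ⟩
  two ℚ.* p ℚ.* (S ℚ.+ ℕ→ℚ u)       ≡⟨ trans (ℕ→ℚ-*-* 2 P (s + u)) (cong (two ℚ.* p ℚ.*_) (ℕ→ℚ-+ s u)) ⟨
  ℕ→ℚ (2 * P * (s + u))             ∎
  where
  open ≡-Reasoning
  p = ℕ→ℚ P
  x = frac u s
  two = ℕ→ℚ 2
  S = ℕ→ℚ s
  expand : ∀ p x t s → p ℚ.* (1ℚ ℚ.+ x) ℚ.* (t ℚ.* s) ≡ t ℚ.* p ℚ.* (s ℚ.+ x ℚ.* s)
  expand = RingSolver.solve-∀ ℚ-ring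

1-frac-slope : ∀ P u s M .{{_ : NonZero s}} → M + 2 * P * u ≡ 2 * P * s →
               ℕ→ℚ P ℚ.* (1ℚ ℚ.- frac u s) ℚ.* ℕ→ℚ (2 * s) ≡ ℕ→ℚ M
1-frac-slope P u s M M+2Pu≡2Ps = begin
  p ℚ.* (1ℚ ℚ.- x) ℚ.* ℕ→ℚ (2 * s)               ≡⟨ cong (p ℚ.* (1ℚ ℚ.- x) ℚ.*_) (ℕ→ℚ-* 2 s) ⟩
  p ℚ.* (1ℚ ℚ.- x) ℚ.* (two ℚ.* S)               ≡⟨ expand p x two S ⟩
  two ℚ.* p ℚ.* S ℚ.- two ℚ.* p ℚ.* (x ℚ.* S)    ≡⟨ cong (λ y → two ℚ.* p ℚ.* S ℚ.- two ℚ.* p ℚ.* y) (frac-* u s) ⟩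
  two ℚ.* p ℚ.* S ℚ.- two ℚ.* p ℚ.* U            ≡⟨ cong (ℚ._- two ℚ.* p ℚ.* U) total ⟨
  ℕ→ℚ M ℚ.+ two ℚ.* p ℚ.* U ℚ.- two ℚ.* p ℚ.* U  ≡⟨ cancel (ℕ→ℚ M) (two ℚ.* p ℚ.* U) ⟩
  ℕ→ℚ M                                          ∎
  where
  open ≡-Reasoning
  p = ℕ→ℚ P
  x = frac u s
  two = ℕ→ℚ 2
  S = ℕ→ℚ s
  U = ℕ→ℚ u
  total : ℕ→ℚ M ℚ.+ two ℚ.* p ℚ.* U ≡ two ℚ.* p ℚ.* S
  total = begin
    ℕ→ℚ M ℚ.+ two ℚ.* p ℚ.* U    ≡⟨ cong (ℕ→ℚ M ℚ.+_) (ℕ→ℚ-*-* 2 P u) ⟨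
    ℕ→ℚ M ℚ.+ ℕ→ℚ (2 * P * u)    ≡⟨ ℕ→ℚ-+ M (2 * P * u) ⟨
    ℕ→ℚ (M + 2 * P * u)          ≡⟨ cong ℕ→ℚ M+2Pu≡2Ps ⟩
    ℕ→ℚ (2 * P * s)              ≡⟨ ℕ→ℚ-*-* 2 P s ⟩
    two ℚ.* p ℚ.* S              ∎
  expand : ∀ p x t s → p ℚ.* (1ℚ ℚ.- x) ℚ.* (t ℚ.* s) ≡ t ℚ.* p ℚ.* s ℚ.- t ℚ.* p ℚ.* (x ℚ.* s)
  expand = RingSolver.solve-∀ ℚ-ring
  cancel : ∀ m y → m ℚ.+ y ℚ.- y ≡ m
  cancel = RingSolver.solve-∀ ℚ-ring

plusSlope : ∀ {d K} P q m ρ Y → 1 ≤ d → K ≡ ρ + q * m → ρ < Y →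
            suc (q * m + Y) ≡ suc d * P + 1 → 2 * P * Y ≡ suc d * P * suc P →
            AchievableSlope d (suc K) (ℕ→ℚ P ℚ.* (1ℚ ℚ.+ frac ρ (Y ∸ ρ)))
plusSlope P q m ρ Y 1≤d refl ρ<Y k+s≡ 2PY≡ =
  achievableSlope (ℕ→ℚ P ℚ.* (1ℚ ℚ.+ frac ρ (Y ∸ ρ))) P (Y ∸ ρ) 1≤d
    (≤-reflexive (trans k+s≡k+Y k+s≡))
    (trans (1+frac-slope P ρ (Y ∸ ρ)) (cong ℕ→ℚ (trans (cong (2 * P *_) s+ρ≡Y) 2PY≡)))
  where
  instance
    s≢0 : NonZero (Y ∸ ρ)
    s≢0 = >-nonZero (m<n⇒0<n∸m ρ<Y)
  s+ρ≡Y : Y ∸ ρ + ρ ≡ Y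
  s+ρ≡Y = m∸n+n≡m (<⇒≤ ρ<Y)
  k+s≡k+Y : suc (ρ + q * m) + (Y ∸ ρ) ≡ suc (q * m + Y)
  k+s≡k+Y = trans (regroup ρ (q * m) (Y ∸ ρ)) (cong (λ y → suc (q * m + y)) s+ρ≡Y)
    where
    regroup : ∀ ρ x s → suc (ρ + x) + s ≡ suc (x + (s + ρ))
    regroup = solve-∀

oddSlope : ∀ {d K} m q ρ → 1 ≤ d → suc d ≡ m + m → K ≡ ρ + q * m → ρ < m →
           AchievableSlope d (suc K) (ℕ→ℚ (suc q) ℚ.* (1ℚ ℚ.+ frac ρ (m * (q + 2) ∸ ρ)))
oddSlope m q ρ 1≤d d+1≡2m K≡ ρ<m = plusSlope (suc q) q m ρ (m * (q + 2)) 1≤d K≡ ρ<Y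
  (trans (layersNeeded q m) (cong (λ D → D * suc q + 1) (sym d+1≡2m)))
  (trans (slopeNumerator q m) (cong (λ D → D * suc q * suc (suc q)) (sym d+1≡2m)))
  where
  ρ<Y : ρ < m * (q + 2)
  ρ<Y = <-≤-trans ρ<m (m≤m*n m (q + 2) {{>-nonZero (<-≤-trans z<s (m≤n+m 2 q))}})
  layersNeeded : ∀ q m → suc (q * m + m * (q + 2)) ≡ (m + m) * suc q + 1
  layersNeeded = solve-∀
  slopeNumerator : ∀ q m → 2 * suc q * (m * (q + 2)) ≡ (m + m) * suc q * suc (suc q)
  slopeNumerator = solve-∀

lowerSlope : ∀ {d K} q ρ → 1 ≤ d → K ≡ ρ + q * suc d → ρ < suc d →
             AchievableSlope d (suc K) (ℕ→ℚ (2 * q + 1) ℚ.* (1ℚ ℚ.+ frac ρ (suc d * suc q ∸ ρ)))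
lowerSlope {d} q ρ 1≤d K≡ ρ<D = plusSlope (2 * q + 1) q (suc d) ρ (suc d * suc q) 1≤d K≡
  (<-≤-trans ρ<D (m≤m*n (suc d) (suc q))) (layersNeeded q (suc d)) (slopeNumerator q (suc d))
  where
  layersNeeded : ∀ q D → suc (q * D + D * suc q) ≡ D * (2 * q + 1) + 1
  layersNeeded = solve-∀
  slopeNumerator : ∀ q D → 2 * (2 * q + 1) * (D * suc q) ≡ D * (2 * q + 1) * suc (2 * q + 1)
  slopeNumerator = solve-∀

upperSlope : ∀ {d K} q ρ → 1 ≤ d → K ≡ ρ + q * suc d → ρ < suc d →
             AchievableSlope d (suc K)
               (ℕ→ℚ (2 * q + 3) ℚ.* (1ℚ ℚ.- frac (d + 2 ∸ suc ρ) (suc d * suc q + (d + 2 ∸ suc ρ))))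
upperSlope {d} q ρ 1≤d refl ρ<D =
  achievableSlope (ℕ→ℚ (2 * q + 3) ℚ.* (1ℚ ℚ.- frac u (suc d * suc q + u)))
    (2 * q + 2) (suc d * suc q + u) 1≤d
    (≤-reflexive k+s≡) (1-frac-slope (2 * q + 3) u (suc d * suc q + u) _ (slopeNumerator q d u))
  where
  u = d + 2 ∸ suc ρ
  u+ρ≡ : u + suc ρ ≡ d + 2
  u+ρ≡ = m∸n+n≡m (≤-trans ρ<D (≤-trans (n≤1+n (suc d)) (≤-reflexive (+-comm 2 d))))
  k+s≡ : suc (ρ + q * suc d) + (suc d * suc q + u) ≡ suc d * (2 * q + 2) + 1
  k+s≡ = begin
    suc (ρ + q * suc d) + (suc d * suc q + u)      ≡⟨ regroup ρ q (suc d) u ⟩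
    q * suc d + suc d * suc q + (u + suc ρ)        ≡⟨ cong (λ y → q * suc d + suc d * suc q + y) u+ρ≡ ⟩
    q * suc d + suc d * suc q + (d + 2)            ≡⟨ layersNeeded q d ⟩
    suc d * (2 * q + 2) + 1                        ∎
    where
    open ≡-Reasoning
    regroup : ∀ ρ q D u → suc (ρ + q * D) + (D * suc q + u) ≡ q * D + D * suc q + (u + suc ρ)
    regroup = solve-∀
    layersNeeded : ∀ q d → q * suc d + suc d * suc q + (d + 2) ≡ suc d * (2 * q + 2) + 1
    layersNeeded = solve-∀
  slopeNumerator : ∀ q d u → suc d * (2 * q + 2) * suc (2 * q + 2) + 2 * (2 * q + 3) * u
                             ≡ 2 * (2 * q + 3) * (suc d * suc q + u)
  slopeNumerator = solve-∀

C-even-achievable : ∀ {d k} → 1 ≤ d → 1 ≤ k → AchievableSlope d k (C-even d k)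
C-even-achievable {d} {suc K} 1≤d _
  with K / suc d | K % suc d | m≡m%n+[m/n]*n K (suc d) | m%n<n K (suc d)
... | q | ρ | K≡ | ρ<D with suc ρ ≤? suc (d / 2)
-- both constructions work for every ρ; the split only follows the definition of C-even
...   | yes _ = lowerSlope q ρ 1≤d K≡ ρ<D
...   | no _  = upperSlope q ρ 1≤d K≡ ρ<D

odd⇒suc≡double : ∀ d {r} → d % 2 ≡ suc r → suc d ≡ suc (d / 2) + suc (d / 2)
odd⇒suc≡double d {r} d%2≡ = begin
  suc d                     ≡⟨ cong suc (m≡m%n+[m/n]*n d 2) ⟩
  suc (d % 2 + d / 2 * 2)   ≡⟨ cong (λ x → suc (x + d / 2 * 2)) (trans d%2≡ (cong suc r≡0)) ⟩
  suc (1 + d / 2 * 2)       ≡⟨ double (d / 2) ⟩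
  suc (d / 2) + suc (d / 2) ∎
  where
  open ≡-Reasoning
  r≡0 : r ≡ 0
  r≡0 = n≤0⇒n≡0 (≤-pred (≤-pred (subst (_< 2) d%2≡ (m%n<n d 2))))
  double : ∀ h → suc (1 + h * 2) ≡ suc h + suc h
  double = solve-∀

C-odd-achievable : ∀ {d k r} → 1 ≤ d → d % 2 ≡ suc r → 1 ≤ k → AchievableSlope d k (C-odd d k)
C-odd-achievable {d} {suc K} 1≤d d%2≡ _ =
  oddSlope m (K / m) (K % m) 1≤d (odd⇒suc≡double d d%2≡) (m≡m%n+[m/n]*n K m) (m%n<n K m)
  where m = suc (d / 2)

proposition3p5 : (d k : ℕ) → 1 ≤ d → 1 ≤ k →
    ∃[ B ] ((n : ℕ) → 1 ≤ n →
      ∃[ Hs ] (IsKCover d n k Hs ×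
        ℕ→ℚ (length Hs) ℚ.≤ C d k ℚ.* ℕ→ℚ n ℚ.+ ℕ→ℚ B))
proposition3p5 d k 1≤d 1≤k with d % 2 in d%2≡
... | zero  = C-even-achievable 1≤d 1≤k
... | suc _ = C-odd-achievable 1≤d d%2≡ 1≤k
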